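{- Let $t\ge 2$ be an integer, let $i,j$ be vertices of $G=D(t-1,t)$, and write $|i-j|=qt+r$ with nonnegative integers $q,r$ and $0\le r<t$. Then $d_G(i,j)\le q+t$.
   Context: The distance graph $D(t-1,t)$ has vertex set $\mathbb{Z}$, two distinct integers $i,j$ being adjacent iff $|i-j|\in\{t-1,t\}$; $d_G$ denotes graph distance. -}

module Defs where

open import Data.Nat using (ℕ; zero; suc; _+_; _∸_; _≤_)
open import Data.Integer using (ℤ; _-_; ∣_∣)
open import Data.Product using (∃; _×_)
open import Data.Sum using (_⊎_)
open import Relation.Binary.PropositionalEquality using (_≡_)

-- Adjacency in the distance graph D(t-1,t) on vertex set ℤ:
-- distinct i, j are adjacent iff |i - j| ∈ {t-1, t}.
-- (For t ≥ 2 both t-1 and t are positive, so distinctness is automatic.)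
Adj : ℕ → ℤ → ℤ → Set
Adj t i j = (∣ i - j ∣ ≡ t ∸ 1) ⊎ (∣ i - j ∣ ≡ t)

data Walk (t : ℕ) : ℤ → ℤ → ℕ → Set where
  here : ∀ {i} → Walk t i i 0
  step : ∀ {i j k n} → Adj t i j → Walk t j k n → Walk t i k (suc n)

DistLe : ℕ → ℤ → ℤ → ℕ → Set
DistLe t i j m = ∃ λ n → n ≤ m × Walk t i j n

-- A walk with m steps of length t and n of length t - 1, taken with signs,
-- moves by m t + n (t - 1) in ∣ m ∣ + ∣ n ∣ steps, so it suffices to write
-- q t + r in this form with ∣ m ∣ + ∣ n ∣ ≤ q + t. With t - 1 = r + c,
-- q t + r = (q - c) t + (c + 1)(t - 1) costs q + 1 steps if c ≤ q and
-- 2c + 1 - q ≤ q + t steps if q < c < r, while for r ≤ c the identity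
-- q t + r = (q + r) t - r (t - 1) costs q + 2r ≤ q + t steps.
module Submission where

open import Defs
open import Data.Nat using (ℕ; suc; _+_; _*_; _∸_; _≤_; _<_; s≤s)
open import Data.Nat.Properties using (m≤m+n; m≤n⇒∃[o]m+o≡n; _≤?_; ≰⇒>)
import Data.Nat.Tactic.RingSolver as ℕ-Solver
open import Data.Integer using (ℤ; +_; -[1+_]; -_; _-_; ∣_∣)
  renaming (_+_ to _+ℤ_; _*_ to _*ℤ_)
open import Data.Integer.Properties
  using ( ∣-i∣≡∣i∣; ∣i-j∣≡∣j-i∣; pos-+; pos-*; neg-distribˡ-*; neg-distribʳ-*
        ; +-assoc; +-comm)
open import Data.Integer.Tactic.RingSolver using (solve-∀)
open import Data.Product using (∃₂; _×_; _,_)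
open import Data.Sum using (_⊎_; inj₁; inj₂)
open import Relation.Binary.PropositionalEquality
  using (_≡_; refl; sym; trans; cong; cong₂; subst; module ≡-Reasoning)
open import Relation.Nullary using (yes; no)

IsStep : ℕ → ℤ → Set
IsStep t s = (∣ s ∣ ≡ t ∸ 1) ⊎ (∣ s ∣ ≡ t)

IsStep-neg : ∀ {t} s → IsStep t s → IsStep t (- s)
IsStep-neg {t} s = subst (λ n → (n ≡ t ∸ 1) ⊎ (n ≡ t)) (sym (∣-i∣≡∣i∣ s))

Adj-+ : ∀ {t} x s → IsStep t s → Adj t x (x +ℤ s)
Adj-+ {t} x s s-step = subst (IsStep t) (sym (x-[x+s]≡-s x s)) (IsStep-neg s s-step)
  where
  x-[x+s]≡-s : ∀ x s → x - (x +ℤ s) ≡ - s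
  x-[x+s]≡-s = solve-∀

walk-++ : ∀ {t x y z m n} → Walk t x y m → Walk t y z n → Walk t x z (m + n)
walk-++ here w = w
walk-++ (step a v) w = step a (walk-++ v w)

walk-iterate : ∀ {t} s → IsStep t s → ∀ n x → Walk t x (x +ℤ + n *ℤ s) n
walk-iterate {t} s _ 0 x = subst (λ y → Walk t x y 0) (sym (x+0*s≡x x s)) here
  where
  x+0*s≡x : ∀ x s → x +ℤ + 0 *ℤ s ≡ x
  x+0*s≡x = solve-∀
walk-iterate {t} s s-step (suc n) x =
  subst (λ y → Walk t x y (suc n)) (shift x s (+ n))
        (step (Adj-+ x s s-step) (walk-iterate s s-step n (x +ℤ s)))
  where
  shift : ∀ x s m → x +ℤ s +ℤ m *ℤ s ≡ x +ℤ (+ 1 +ℤ m) *ℤ s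
  shift = solve-∀

walk-multiple : ∀ {t} s → IsStep t s → ∀ m x → Walk t x (x +ℤ m *ℤ s) ∣ m ∣
walk-multiple s s-step (+ n) x = walk-iterate s s-step n x
walk-multiple {t} s s-step -[1+ n ] x =
  subst (λ y → Walk t x y (suc n)) (cong (x +ℤ_) [1+n]*-s≡-[1+n]*s)
        (walk-iterate (- s) (IsStep-neg s s-step) (suc n) x)
  where
  [1+n]*-s≡-[1+n]*s : + suc n *ℤ (- s) ≡ -[1+ n ] *ℤ s
  [1+n]*-s≡-[1+n]*s = trans (sym (neg-distribʳ-* (+ suc n) s)) (neg-distribˡ-* (+ suc n) s)

StepCombination : ℕ → ℤ → ℕ → Set
StepCombination t d L = ∃₂ λ m n → m *ℤ + t +ℤ n *ℤ + (t ∸ 1) ≡ d × ∣ m ∣ + ∣ n ∣ ≤ L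

walk-combination : ∀ t m n x → Walk t x (x +ℤ (m *ℤ + t +ℤ n *ℤ + (t ∸ 1))) (∣ m ∣ + ∣ n ∣)
walk-combination t m n x =
  subst (λ y → Walk t x y (∣ m ∣ + ∣ n ∣)) (+-assoc x (m *ℤ + t) (n *ℤ + (t ∸ 1)))
    (walk-++ (walk-multiple (+ t) (inj₂ refl) m x)
             (walk-multiple (+ (t ∸ 1)) (inj₁ refl) n (x +ℤ m *ℤ + t)))

DistLe-combination : ∀ {t i j L} → StepCombination t (j - i) L → DistLe t i j L
DistLe-combination {t} {i} {j} (m , n , sum≡j-i , bound) =
  ∣ m ∣ + ∣ n ∣ , bound ,
  subst (λ y → Walk t i y (∣ m ∣ + ∣ n ∣)) (trans (cong (i +ℤ_) sum≡j-i) (i+[j-i]≡j i j))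
    (walk-combination t m n i)
  where
  i+[j-i]≡j : ∀ i j → i +ℤ (j - i) ≡ j
  i+[j-i]≡j = solve-∀

StepCombination-neg : ∀ {t d L} → StepCombination t d L → StepCombination t (- d) L
StepCombination-neg {t} {L = L} (m , n , sum≡d , bound) =
  - m , - n ,
  trans (neg-sum m n (+ t) (+ (t ∸ 1))) (cong -_ sum≡d) ,
  subst (_≤ L) (sym (cong₂ _+_ (∣-i∣≡∣i∣ m) (∣-i∣≡∣i∣ n))) bound
  where
  neg-sum : ∀ m n a b → - m *ℤ a +ℤ - n *ℤ b ≡ - (m *ℤ a +ℤ n *ℤ b)
  neg-sum = solve-∀

StepCombination-∣∣ : ∀ {t L} d → StepCombination t (+ ∣ d ∣) L → StepCombination t d L
StepCombination-∣∣ (+ n) c = c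
StepCombination-∣∣ -[1+ n ] c = StepCombination-neg c

pos-*-+-pos-* : ∀ a t b u {d} → a * t + b * u ≡ d → + a *ℤ + t +ℤ + b *ℤ + u ≡ + d
pos-*-+-pos-* a t b u {d} e = begin
  + a *ℤ + t +ℤ + b *ℤ + u  ≡⟨ cong₂ _+ℤ_ (sym (pos-* a t)) (sym (pos-* b u)) ⟩
  + (a * t) +ℤ + (b * u)    ≡⟨ sym (pos-+ (a * t) (b * u)) ⟩
  + (a * t + b * u)         ≡⟨ cong +_ e ⟩
  + d                       ∎
  where open ≡-Reasoning

pos-*-+-neg-* : ∀ a t b u {d} → a * t ≡ b * u + d → + a *ℤ + t +ℤ - + b *ℤ + u ≡ + d
pos-*-+-neg-* a t b u {d} e = begin
  + a *ℤ + t +ℤ - + b *ℤ + u      ≡⟨ cong₂ _+ℤ_ (sym (pos-* a t)) (sym (neg-distribˡ-* (+ b) (+ u))) ⟩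
  + (a * t) +ℤ - (+ b *ℤ + u)     ≡⟨ cong₂ (λ k l → + k +ℤ - l) e (sym (pos-* b u)) ⟩
  + (b * u + d) +ℤ - + (b * u)    ≡⟨ cong (_+ℤ - + (b * u)) (pos-+ (b * u) d) ⟩
  + (b * u) +ℤ + d +ℤ - + (b * u) ≡⟨ x+y-x≡y (+ (b * u)) (+ d) ⟩
  + d                             ∎
  where
  open ≡-Reasoning
  x+y-x≡y : ∀ x y → x +ℤ y +ℤ - x ≡ y
  x+y-x≡y = solve-∀

neg-*-+-pos-* : ∀ a t b u {d} → b * u ≡ a * t + d → - + a *ℤ + t +ℤ + b *ℤ + u ≡ + d
neg-*-+-pos-* a t b u e = trans (+-comm (- + a *ℤ + t) (+ b *ℤ + u)) (pos-*-+-neg-* b u a t e)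

m+k≡n⇒m≤n : ∀ {m n} k → m + k ≡ n → m ≤ n
m+k≡n⇒m≤n k refl = m≤m+n _ k

combination-pos-pos : ∀ {u q r c} → r + c ≡ u → c ≤ q →
  StepCombination (suc u) (+ (q * suc u + r)) (q + suc u)
combination-pos-pos {r = r} {c} refl c≤q with m≤n⇒∃[o]m+o≡n c≤q
... | a , refl =
  + a , + suc c ,
  pos-*-+-pos-* a (suc (r + c)) (suc c) (r + c) (identity a c r) ,
  m+k≡n⇒m≤n (r + c) (slack a c r)
  where
  identity : ∀ a c r → a * suc (r + c) + suc c * (r + c) ≡ (c + a) * suc (r + c) + r
  identity = ℕ-Solver.solve-∀
  slack : ∀ a c r → a + suc c + (r + c) ≡ c + a + suc (r + c)
  slack = ℕ-Solver.solve-∀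

combination-pos-neg : ∀ {u q r c} → r + c ≡ u → r ≤ c →
  StepCombination (suc u) (+ (q * suc u + r)) (q + suc u)
combination-pos-neg {q = q} {r} refl r≤c with m≤n⇒∃[o]m+o≡n r≤c
... | e , refl =
  + (q + r) , - + r ,
  pos-*-+-neg-* (q + r) (suc (r + (r + e))) r (r + (r + e)) (identity q r (r + (r + e))) ,
  subst (_≤ q + suc (r + (r + e))) (cong (λ k → q + r + k) (sym (∣-i∣≡∣i∣ (+ r))))
        (m+k≡n⇒m≤n (suc e) (slack q r e))
  where
  identity : ∀ q r u → (q + r) * suc u ≡ r * u + (q * suc u + r)
  identity = ℕ-Solver.solve-∀
  slack : ∀ q r e → q + r + r + suc e ≡ q + suc (r + (r + e))
  slack = ℕ-Solver.solve-∀

combination-neg-pos : ∀ {u q r c} → r + c ≡ u → q < c → c < r →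
  StepCombination (suc u) (+ (q * suc u + r)) (q + suc u)
combination-neg-pos {q = q} refl q<c c<r
  with m≤n⇒∃[o]m+o≡n q<c | m≤n⇒∃[o]m+o≡n c<r
... | b , refl | e , refl =
  - + suc b , + suc (suc q + b) ,
  neg-*-+-pos-* (suc b) (suc (suc (suc q + b) + e + (suc q + b)))
                (suc (suc q + b)) (suc (suc q + b) + e + (suc q + b)) (identity q b e) ,
  m+k≡n⇒m≤n (q + q + e + 1) (slack q b e)
  where
  identity : ∀ q b e →
    suc (suc q + b) * (suc (suc q + b) + e + (suc q + b))
      ≡ suc b * suc (suc (suc q + b) + e + (suc q + b))
        + (q * suc (suc (suc q + b) + e + (suc q + b)) + (suc (suc q + b) + e))
  identity = ℕ-Solver.solve-∀
  slack : ∀ q b e → suc b + suc (suc q + b) + (q + q + e + 1)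
                    ≡ q + suc (suc (suc q + b) + e + (suc q + b))
  slack = ℕ-Solver.solve-∀

combination-q*t+r : ∀ u q r → r ≤ u → StepCombination (suc u) (+ (q * suc u + r)) (q + suc u)
combination-q*t+r u q r r≤u with m≤n⇒∃[o]m+o≡n r≤u
... | c , r+c≡u with c ≤? q
...   | yes c≤q = combination-pos-pos r+c≡u c≤q
...   | no c≰q with r ≤? c
...     | yes r≤c = combination-pos-neg r+c≡u r≤c
...     | no r≰c = combination-neg-pos r+c≡u (≰⇒> c≰q) (≰⇒> r≰c)

lemma4 : (t : ℕ) → 2 ≤ t → (i j : ℤ) → (q r : ℕ) → r < t →
    ∣ i - j ∣ ≡ q * t + r → DistLe t i j (q + t)
lemma4 (suc u) _ i j q r (s≤s r≤u) ∣i-j∣≡qt+r =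
  DistLe-combination (StepCombination-∣∣ (j - i) combination-of-∣j-i∣)
  where
  ∣j-i∣≡qt+r : ∣ j - i ∣ ≡ q * suc u + r
  ∣j-i∣≡qt+r = trans (∣i-j∣≡∣j-i∣ j i) ∣i-j∣≡qt+r
  combination-of-∣j-i∣ : StepCombination (suc u) (+ ∣ j - i ∣) (q + suc u)
  combination-of-∣j-i∣ = subst (λ d → StepCombination (suc u) (+ d) (q + suc u))
                                (sym ∣j-i∣≡qt+r) (combination-q*t+r u q r r≤u)
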